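{- Every finite atomistic lattice is isomorphic to $\langle U(P_f),\subset\rangle$ for some monotone Boolean function $f$.
   Context: A Boolean function $f:\{0,1\}^n\to\{0,1\}$ is monotone if $x\le y$ (coordinatewise) implies $f(x)\le f(y)$. A set $I\subseteq[n]$ is a prime implicant of $f$ if the implication $(\forall i\in I: x_i=1)\Rightarrow f(x)=1$ holds for $I$ but fails for every proper subset of $I$; $P_f$ is the set of prime implicants of $f$. $U(P_f)$ is the set $\{\bigcup_{b\in B}b\mid B\subseteq P_f\}$ (including the empty union $\emptyset$), ordered by inclusion. A finite lattice is atomistic if every element is a join of atoms. -}

module Defs where

open import Level using (Level; _⊔_)
open import Data.Nat using (ℕ)
open import Data.Fin using (Fin)
open import Data.Bool using (Bool; true; false)
import Data.Bool as B
open import Data.Vec using (Vec)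
open import Data.List using (List; [])
open import Data.List.Relation.Unary.All using (All)
open import Data.Product using (Σ; ∃; ∃-syntax; _×_; proj₁)
open import Data.Sum using (_⊎_)
open import Data.Fin.Subset using (Subset; _⊆_; _⊂_; ⋃)
open import Relation.Nullary using (¬_)
open import Relation.Binary.PropositionalEquality using (_≡_)
open import Relation.Binary.Lattice.Bundles using (Lattice)
open import Relation.Binary.Morphism.Structures using (IsOrderIsomorphism)

-- Boolean functions {0,1}^n → {0,1}; an input x is a Bool vector, and
-- "x_i = 1" is exactly "i ∈ x" when x is read as a Subset n (= Vec Bool n).
BoolFun : ℕ → Set
BoolFun n = Vec Bool n → Bool

Monotone : ∀ {n} → BoolFun n → Set
Monotone f = ∀ x y → x ⊆ y → f x B.≤ f y

Implies : ∀ {n} → BoolFun n → Subset n → Set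
Implies f I = ∀ x → I ⊆ x → f x ≡ true

PrimeImplicant : ∀ {n} → BoolFun n → Subset n → Set
PrimeImplicant f I = Implies f I × (∀ J → J ⊂ I → ¬ Implies f J)

-- S ∈ U(P_f): S is the union of some collection B ⊆ P_f (B = [] gives ∅)
InU : ∀ {n} → BoolFun n → Subset n → Set
InU f S = ∃[ bs ] (All (PrimeImplicant f) bs × S ≡ ⋃ bs)

UP : ∀ {n} → BoolFun n → Set
UP {n} f = Σ (Subset n) (InU f)

_≈U_ : ∀ {n} {f : BoolFun n} → UP f → UP f → Set
a ≈U b = proj₁ a ≡ proj₁ b

_⊆U_ : ∀ {n} {f : BoolFun n} → UP f → UP f → Set
a ⊆U b = proj₁ a ⊆ proj₁ b

module _ {c ℓ₁ ℓ₂ : Level} (L : Lattice c ℓ₁ ℓ₂) where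
  open Lattice L

  Finite : Set (c ⊔ ℓ₁)
  Finite = ∃[ m ] Σ (Fin m → Carrier) (λ e → ∀ x → ∃[ i ] e i ≈ x)

  IsLeast : Carrier → Set (c ⊔ ℓ₂)
  IsLeast x = ∀ y → x ≤ y

  IsAtom : Carrier → Set (c ⊔ ℓ₁ ⊔ ℓ₂)
  IsAtom a = ¬ IsLeast a × (∀ x → x ≤ a → x ≈ a ⊎ IsLeast x)

  IsJoinOf : Carrier → List Carrier → Set (c ⊔ ℓ₂)
  IsJoinOf x xs = All (_≤ x) xs × (∀ u → All (_≤ u) xs → x ≤ u)

  Atomistic : Set (c ⊔ ℓ₁ ⊔ ℓ₂)
  Atomistic = ∀ x → ∃[ as ] (All IsAtom as × IsJoinOf x as)

module Submission where

-- Enumerate the lattice as e₀, …, e_{m-1} and record an element x by the set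
-- M x = {i | x ≰ eᵢ}. Because every element is a join of atoms, x ≰ y holds
-- exactly when some atom below x is not below y, so M turns joins into unions
-- and is an order embedding. The monotone function f that is true on v iff v
-- contains M a for some atom a has the sets M a as its prime implicants (they
-- form an antichain), so U(P_f) is precisely the image of M.

open import Defs
open import Level using (Level; _⊔_)
open import Data.Nat using (ℕ; zero; suc)
open import Data.Product using (Σ; ∃-syntax; _×_; _,_; proj₁; proj₂; uncurry)
open import Relation.Binary.Lattice.Bundles using (Lattice)
open import Relation.Binary.Morphism.Structures using (IsOrderIsomorphism)

open import Function using (_∘_; _⇔_; mk⇔; Equivalence)
open import Data.Bool using (true; false; f≤t; b≤b)
import Data.Bool as B
open import Data.Empty using (⊥-elim)
open import Data.Fin using (Fin)
import Data.Fin as Fin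
open import Data.Fin.Properties using (any?)
open import Data.Fin.Subset using (Subset; _⊆_; _⊂_; _∈_; ⋃)
open import Data.Fin.Subset.Properties
  using (_∈?_; _⊆?_; ⊆-refl; ⊆-reflexive; ⊆-trans; ⊆-antisym; x∈p∪q⁺; x∈p∪q⁻; ∉⊥)
open import Data.List using (List; []; _∷_; map; foldr)
open import Data.List.Relation.Unary.All as All using (All; []; _∷_)
import Data.List.Relation.Unary.All.Properties as All
open import Data.List.Relation.Unary.Any as Any using (Any; here; there)
import Data.List.Relation.Unary.Any.Properties as Any
open import Data.Sum using (inj₁; inj₂; [_,_]; map₁)
open import Data.Vec using (tabulate)
open import Data.Vec.Properties using (lookup∘tabulate; []=⇒lookup; lookup⇒[]=)
open import Relation.Binary.Definitions using (Decidable)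
open import Relation.Nullary using (¬_; Dec; yes; no; does; ¬?; _×-dec_)
open import Relation.Nullary.Decidable using (dec-true; map′; decidable-stable)
open import Relation.Binary.PropositionalEquality
  using (_≡_; refl; sym; trans; cong; subst; module ≡-Reasoning)
open import Relation.Unary using (Pred)

open Equivalence using (to; from)

does≡true⇒ : ∀ {a} {A : Set a} (a? : Dec A) → does a? ≡ true → A
does≡true⇒ (yes a) _ = a
does≡true⇒ (no _) ()

all-dec : ∀ {a p} {A : Set a} {P : Pred A p} {xs : List A} →
          All (Dec ∘ P) xs → Dec (All P xs)
all-dec [] = yes []
all-dec (p? ∷ ps?) = map′ (uncurry _∷_) All.uncons (p? ×-dec all-dec ps?)

≤-fromImplication : ∀ {b c} → (b ≡ true → c ≡ true) → b B.≤ c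
≤-fromImplication {false} {false} _ = b≤b
≤-fromImplication {false} {true}  _ = f≤t
≤-fromImplication {true}  h with h refl
... | refl = b≤b

module _ {n : ℕ} where

  ∈-tabulate-does : ∀ {p} {P : Pred (Fin n) p} (P? : ∀ i → Dec (P i)) {i} →
                    i ∈ tabulate (does ∘ P?) ⇔ P i
  ∈-tabulate-does P? {i} = mk⇔
    (λ i∈ → does≡true⇒ (P? i) (trans (sym (lookup∘tabulate _ i)) ([]=⇒lookup i∈)))
    (λ Pi → lookup⇒[]= i _ (trans (lookup∘tabulate _ i) (dec-true (P? i) Pi)))

  ∈⋃⁺ : ∀ {i} {ps : List (Subset n)} → Any (i ∈_) ps → i ∈ ⋃ ps
  ∈⋃⁺ (here i∈p)  = x∈p∪q⁺ (inj₁ i∈p)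
  ∈⋃⁺ (there i∈ps) = x∈p∪q⁺ (inj₂ (∈⋃⁺ i∈ps))

  ∈⋃⁻ : ∀ {i} (ps : List (Subset n)) → i ∈ ⋃ ps → Any (i ∈_) ps
  ∈⋃⁻ []       i∈ = ⊥-elim (∉⊥ i∈)
  ∈⋃⁻ (p ∷ ps) i∈ with x∈p∪q⁻ p (⋃ ps) i∈
  ... | inj₁ i∈p  = here i∈p
  ... | inj₂ i∈ps = there (∈⋃⁻ ps i∈ps)

  Generates : ∀ {q} → Pred (Subset n) q → BoolFun n → Set q
  Generates Q f = ∀ v → f v ≡ true ⇔ (∃[ S ] Q S × S ⊆ v)

  Antichain : ∀ {q} → Pred (Subset n) q → Set q
  Antichain Q = ∀ {S T} → Q S → Q T → S ⊆ T → S ≡ T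

  module _ {q} {Q : Pred (Subset n) q} {f : BoolFun n} (gen : Generates Q f) where

    generated⇒monotone : Monotone f
    generated⇒monotone x y x⊆y = ≤-fromImplication λ fx → from (gen y)
      (let S , QS , S⊆x = to (gen x) fx in S , QS , ⊆-trans S⊆x x⊆y)

    generated⇒implies : ∀ {S} → Q S → Implies f S
    generated⇒implies QS x S⊆x = from (gen x) (_ , QS , S⊆x)

    antichain⇒primeImplicant : Antichain Q → ∀ {I} → Q I → PrimeImplicant f I
    antichain⇒primeImplicant antichain QI = generated⇒implies QI , minimal
      where
      minimal : ∀ J → J ⊂ _ → ¬ Implies f J
      minimal J (J⊆I , j , j∈I , j∉J) impJ =
        let S , QS , S⊆J = to (gen J) (impJ J ⊆-refl)
            S≡I = antichain QS QI (⊆-trans S⊆J J⊆I)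
        in j∉J (S⊆J (subst (j ∈_) (sym S≡I) j∈I))

    primeImplicant⇒member : ∀ {I} → PrimeImplicant f I → Q I
    primeImplicant⇒member {I} (impI , minimal) with to (gen I) (impI I ⊆-refl)
    ... | S , QS , S⊆I = subst Q (⊆-antisym S⊆I I⊆S) QS
      where
      I⊆S : I ⊆ S
      I⊆S {j} j∈I = decidable-stable (j ∈? S)
        λ j∉S → minimal S (S⊆I , j , j∈I , j∉S) (generated⇒implies QS)

module _ {c ℓ₁ ℓ₂ : Level} (L : Lattice c ℓ₁ ℓ₂) where

  open Lattice L renaming (refl to ≤-refl; trans to ≤-trans)

  IsAtom-resp-≈ : ∀ {x y} → x ≈ y → IsAtom L x → IsAtom L y
  IsAtom-resp-≈ x≈y (notLeast , covers) =
      (λ yLeast → notLeast (≤-trans (reflexive x≈y) ∘ yLeast))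
    , λ z z≤y → map₁ (λ z≈x → Eq.trans z≈x x≈y)
                  (covers z (≤-trans z≤y (reflexive (Eq.sym x≈y))))

  atom≤? : ∀ {a} → IsAtom L a → ∀ x → Dec (a ≤ x)
  atom≤? {a} (notLeast , covers) x with covers (a ∧ x) (x∧y≤x a x)
  ... | inj₁ a∧x≈a   = yes (≤-trans (reflexive (Eq.sym a∧x≈a)) (x∧y≤y a x))
  ... | inj₂ a∧xLeast = no λ a≤x → notLeast (≤-trans (∧-greatest ≤-refl a≤x) ∘ a∧xLeast)

  -- The seed x is only the empty meet; Finite L alone does not supply an element.
  meetOver : Carrier → ∀ {k} → (Fin k → Carrier) → Carrier
  meetOver x {zero}  g = x
  meetOver x {suc k} g = g Fin.zero ∧ meetOver x (g ∘ Fin.suc)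

  meetOver-≤ : ∀ x {k} (g : Fin k → Carrier) i → meetOver x g ≤ g i
  meetOver-≤ x g Fin.zero    = x∧y≤x _ _
  meetOver-≤ x g (Fin.suc i) = ≤-trans (x∧y≤y _ _) (meetOver-≤ x (g ∘ Fin.suc) i)

  finite⇒least : Finite L → Carrier → ∃[ bot ] IsLeast L bot
  finite⇒least (_ , e , e-onto) x = meetOver x e , λ y →
    let i , ei≈y = e-onto y in ≤-trans (meetOver-≤ x e i) (reflexive ei≈y)

  foldr-∨-isJoinOf : ∀ {bot} → IsLeast L bot → ∀ xs → IsJoinOf L (foldr _∨_ bot xs) xs
  foldr-∨-isJoinOf bot-least [] = [] , λ u _ → bot-least u
  foldr-∨-isJoinOf bot-least (x ∷ xs) =
    let below , lub = foldr-∨-isJoinOf bot-least xs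
    in  x≤x∨y _ _ ∷ All.map (λ y≤j → ≤-trans y≤j (y≤x∨y _ _)) below
      , λ { u (x≤u ∷ xs≤u) → ∨-least x≤u (lub u xs≤u) }

  module _ (atomistic : Atomistic L) where

    _≤?_ : Decidable _≤_
    x ≤? y =
      let as , atoms , below , lub = atomistic x
      in  map′ (lub y) (λ x≤y → All.map (λ a≤x → ≤-trans a≤x x≤y) below)
               (all-dec (All.map (λ atomA → atom≤? atomA y) atoms))

    isAtom? : ∀ x → Dec (IsAtom L x)
    isAtom? x with atomistic x
    ... | [] , _ , _ , lub = no λ (notLeast , _) → notLeast λ u → lub u []
    ... | a ∷ _ , atomA ∷ _ , a≤x ∷ _ , _ with x ≤? a
    ...   | yes x≤a = yes (IsAtom-resp-≈ (antisym a≤x x≤a) atomA)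
    ...   | no  x≰a = no λ (_ , covers) →
                [ x≰a ∘ reflexive ∘ Eq.sym , proj₁ atomA ] (covers a a≤x)

    module Representation {m : ℕ} (e : Fin m → Carrier) (e-onto : ∀ x → ∃[ i ] e i ≈ x)
                          {bot : Carrier} (bot-least : IsLeast L bot) where

      M : Carrier → Subset m
      M x = tabulate λ i → does (¬? (x ≤? e i))

      ∈M⇔ : ∀ {x i} → i ∈ M x ⇔ (¬ x ≤ e i)
      ∈M⇔ {x} = ∈-tabulate-does (λ i → ¬? (x ≤? e i))

      M-mono : ∀ {x y} → x ≤ y → M x ⊆ M y
      M-mono x≤y i∈Mx = from ∈M⇔ λ y≤ei → to ∈M⇔ i∈Mx (≤-trans x≤y y≤ei)

      M-cancel : ∀ {x y} → M x ⊆ M y → x ≤ y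
      M-cancel {x} {y} Mx⊆My =
        let i , ei≈y = e-onto y
            x≤ei = decidable-stable (x ≤? e i) λ x≰ei →
                     to ∈M⇔ (Mx⊆My (from ∈M⇔ x≰ei)) (reflexive (Eq.sym ei≈y))
        in  ≤-trans x≤ei (reflexive ei≈y)

      M-cong : ∀ {x y} → x ≈ y → M x ≡ M y
      M-cong x≈y = ⊆-antisym (M-mono (reflexive x≈y)) (M-mono (reflexive (Eq.sym x≈y)))

      M-injective : ∀ {x y} → M x ≡ M y → x ≈ y
      M-injective Mx≡My = antisym (M-cancel (⊆-reflexive Mx≡My)) (M-cancel (⊆-reflexive (sym Mx≡My)))

      M-join : ∀ {x xs} → IsJoinOf L x xs → M x ≡ ⋃ (map M xs)
      M-join {x} {xs} (below , lub) = ⊆-antisym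
        (λ {i} i∈Mx → ∈⋃⁺ (Any.map⁺ (Any.map (from ∈M⇔)
           (All.¬All⇒Any¬ (_≤? e i) xs (to ∈M⇔ i∈Mx ∘ lub (e i))))))
        (λ {i} i∈⋃ → from ∈M⇔ λ x≤ei →
           All.Any¬⇒¬All (Any.map (to ∈M⇔) (Any.map⁻ (∈⋃⁻ (map M xs) i∈⋃)))
                         (All.map (λ y≤x → ≤-trans y≤x x≤ei) below))

      IsAtomImage : Pred (Subset m) (c ⊔ ℓ₁ ⊔ ℓ₂)
      IsAtomImage S = ∃[ a ] IsAtom L a × S ≡ M a

      atomImages-antichain : Antichain IsAtomImage
      atomImages-antichain (a , atomA , refl) (b , (_ , coversB) , refl) Ma⊆Mb
        with coversB a (M-cancel Ma⊆Mb)
      ... | inj₁ a≈b   = M-cong a≈b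
      ... | inj₂ aLeast = ⊥-elim (proj₁ atomA aLeast)

      containsAtomImage? : ∀ v i → Dec (IsAtom L (e i) × M (e i) ⊆ v)
      containsAtomImage? v i = isAtom? (e i) ×-dec M (e i) ⊆? v

      f : BoolFun m
      f v = does (any? (containsAtomImage? v))

      f-generated : Generates IsAtomImage f
      f-generated v = mk⇔ (fromIndex ∘ does≡true⇒ (any? (containsAtomImage? v)))
                          (dec-true (any? (containsAtomImage? v)) ∘ toIndex)
        where
        fromIndex : ∃[ i ] IsAtom L (e i) × M (e i) ⊆ v → ∃[ S ] IsAtomImage S × S ⊆ v
        fromIndex (i , atomEi , Mei⊆v) = M (e i) , (e i , atomEi , refl) , Mei⊆v

        toIndex : ∃[ S ] IsAtomImage S × S ⊆ v → ∃[ i ] IsAtom L (e i) × M (e i) ⊆ v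
        toIndex (_ , (a , atomA , refl) , Ma⊆v) =
          let i , ei≈a = e-onto a
          in  i , IsAtom-resp-≈ (Eq.sym ei≈a) atomA , ⊆-trans (M-mono (reflexive ei≈a)) Ma⊆v

      M∈U : ∀ x → InU f (M x)
      M∈U x =
        let as , atoms , join = atomistic x
        in  map M as
          , All.map⁺ (All.map (λ atomA → antichain⇒primeImplicant f-generated
                                            atomImages-antichain (_ , atomA , refl)) atoms)
          , M-join join

      φ : Carrier → UP f
      φ x = M x , M∈U x

      atomImages-lift : ∀ {bs} → All IsAtomImage bs → ∃[ as ] map M as ≡ bs
      atomImages-lift [] = [] , refl
      atomImages-lift ((a , _ , refl) ∷ images) =
        let as , Mas≡bs = atomImages-lift images in a ∷ as , cong (M a ∷_) Mas≡bs

      φ-surjective : ∀ (y : UP f) → ∃[ x ] (∀ {z} → z ≈ x → φ z ≈U y)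
      φ-surjective (S , bs , primes , S≡⋃bs) =
        let as , Mas≡bs = atomImages-lift (All.map (primeImplicant⇒member f-generated) primes)
        in  foldr _∨_ bot as , λ {z} z≈x → begin
              M z                     ≡⟨ M-cong z≈x ⟩
              M (foldr _∨_ bot as)    ≡⟨ M-join (foldr-∨-isJoinOf bot-least as) ⟩
              ⋃ (map M as)            ≡⟨ cong ⋃ Mas≡bs ⟩
              ⋃ bs                    ≡⟨ sym S≡⋃bs ⟩
              S                       ∎
        where open ≡-Reasoning

      φ-isOrderIsomorphism : IsOrderIsomorphism _≈_ _≈U_ _≤_ _⊆U_ φ
      φ-isOrderIsomorphism = record
        { isOrderMonomorphism = record
          { isOrderHomomorphism = record { cong = M-cong ; mono = M-mono }
          ; injective           = M-injective
          ; cancel              = M-cancel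
          }
        ; surjective = φ-surjective
        }

mainTheorem2 : ∀ {c ℓ₁ ℓ₂ : Level} (L : Lattice c ℓ₁ ℓ₂) →
    Finite L → Lattice.Carrier L → Atomistic L →
    ∃[ n ] Σ (BoolFun n) λ f → Monotone f ×
      Σ (Lattice.Carrier L → UP f) λ φ →
        IsOrderIsomorphism (Lattice._≈_ L) _≈U_ (Lattice._≤_ L) _⊆U_ φ
mainTheorem2 L finite@(m , e , e-onto) x atomistic =
  m , f , generated⇒monotone f-generated , φ , φ-isOrderIsomorphism
  where
  open Representation L atomistic e e-onto (proj₂ (finite⇒least L finite x))
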